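{- Let $k,\ell\ge2$ and $c\le 1$. There is a constant $\delta>0$ such that with high probability (probability tending to $1$ as $n\to\infty$) the following holds: no set $S\subseteq\mathbb{Z}_n$ of $t$ vertices of $\hat W_n$ with $0<t<\delta n$ induces edges of total weight at least $\ell t$.
   Context: **Random choices.** Let $\mathbb{Z}_n=\{0,\dots,n-1\}$. Choose $e_1,\dots,e_{cn}$ independently; each is a multiset of $k$ independent uniform elements of $\mathbb{Z}_n$. **Weighted hypergraph $\hat W_n$.** - Vertex set $\mathbb{Z}_n$, each vertex of weight $\ell$ (so a set of $t$ vertices has weight $\ell t$). - Helper edges $\{i,i+1\}$ for $i\in\mathbb{Z}_n$, each of weight $\ell-1$. - Ordinary edges $e_1,\dots,e_{cn}$, each of weight $1$. A set $S$ of vertices induces an edge if all vertices of the edge lie in $S$. -}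

module Defs where

open import Data.Bool using (Bool; true; false; _∧_)
open import Data.Nat using (ℕ; zero; suc; _+_; _*_; _∸_; _^_; _≤ᵇ_; _<ᵇ_)
open import Data.Nat.DivMod using (_%_; m%n<n)
open import Data.Fin using (Fin; toℕ; fromℕ<)
open import Data.Vec as V using (Vec; []; _∷_; lookup)
open import Data.Bool.ListAction as BL using ()
open import Data.List as L using (List; []; _∷_; concatMap; allFin)

countL : {A : Set} → (A → Bool) → List A → ℕ
countL p [] = 0
countL p (x ∷ xs) with p x
... | true  = suc (countL p xs)
... | false = countL p xs

vecs : {A : Set} → List A → (k : ℕ) → List (Vec A k)
vecs xs zero    = [] ∷ []
vecs xs (suc k) = concatMap (λ x → L.map (x ∷_) (vecs xs k)) xs

next : {n : ℕ} → Fin n → Fin n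
next {suc n} i = fromℕ< (m%n<n (suc (toℕ i)) (suc n))

Subset : ℕ → Set
Subset n = Vec Bool n

allSubsets : (n : ℕ) → List (Subset n)
allSubsets n = vecs (true ∷ false ∷ []) n

size : {n : ℕ} → Subset n → ℕ
size S = countL (λ b → b) (V.toList S)

-- An ordinary edge: a multiset of k vertices, given by an ordered k-tuple.
Edge : ℕ → ℕ → Set
Edge n k = Vec (Fin n) k

-- An outcome of the random choices: the m edges e_1..e_m.
Outcome : ℕ → ℕ → ℕ → Set
Outcome n k m = Vec (Edge n k) m

-- all outcomes (each equally likely; there are n^(k*m) of them)
allOutcomes : (n k m : ℕ) → List (Outcome n k m)
allOutcomes n k m = vecs (vecs (allFin n) k) m

helperInduced : {n : ℕ} → Subset n → ℕ
helperInduced {n} S = countL (λ i → lookup S i ∧ lookup S (next i)) (allFin n)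

inducesEdge : {n k : ℕ} → Subset n → Edge n k → Bool
inducesEdge S e = BL.all (lookup S) (V.toList e)

ordinaryInduced : {n k m : ℕ} → Subset n → Outcome n k m → ℕ
ordinaryInduced S es = countL (inducesEdge S) (V.toList es)

-- total weight of edges induced by S in Ŵ_n (helper edges weight ℓ-1, ordinary edges weight 1)
inducedWeight : {n k m : ℕ} → (ℓ : ℕ) → Subset n → Outcome n k m → ℕ
inducedWeight ℓ S es = (ℓ ∸ 1) * helperInduced S + ordinaryInduced S es

-- S is a "bad" set: 0 < t, t < n/D (i.e. t*D < n, δ = 1/D), induced weight ≥ ℓ t where t = |S|
badSet : {n k m : ℕ} → (ℓ D : ℕ) → Outcome n k m → Subset n → Bool
badSet {n} ℓ D es S =
  (0 <ᵇ size S) ∧ ((size S * D <ᵇ n) ∧ (ℓ * size S ≤ᵇ inducedWeight ℓ S es))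

badOutcome : {n k m : ℕ} → (ℓ D : ℕ) → Outcome n k m → Bool
badOutcome {n} ℓ D es = BL.any (badSet ℓ D es) (allSubsets n)

badCount : (n k m ℓ D : ℕ) → ℕ
badCount n k m ℓ D = countL (badOutcome ℓ D) (allOutcomes n k m)

module Submission where

-- A bad set S with t = |S| spans h helper edges and, writing u for the number of
-- i ∈ S with i + 1 ∉ S, t = h + u; so weight ≥ ℓt forces at least t + u ordinary
-- edges inside S.  Each ordinary edge lies in S with probability (t/n)^k, and an
-- exponential moment with base q = ⌊n/t⌋ bounds the probability that S is bad by
-- (1 + 1/q)^m q^-(t+u).  Summed over all S of size t, the factor q^-u is controlled
-- by a 2×2 transfer matrix around the cycle ℤ_n in which 2^-|S| marks the size; it
-- contributes at most 2^t · 2(1 + 1/q)^n.  As m ≤ n < 2qt and (1 + 1/q)^q ≤ 4, the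
-- bad sets of size t occur with probability at most 2(1024t/n)^t, and summing over
-- t < n/4096 gives O(1/n).

open import Defs
open import Data.Bool using (Bool; true; false; _∧_; _∨_; not; T)
open import Data.Bool.Properties using (T-∧; T-≡; ∧-zeroʳ)
import Data.Bool.ListAction as BL
open import Data.Fin using (Fin; zero; suc; toℕ; inject₁; fromℕ)
open import Data.Fin.Properties using (toℕ-injective; toℕ-fromℕ<; toℕ-inject₁; toℕ<n; toℕ-fromℕ)
open import Data.List as L using (List; []; _∷_; _++_; concatMap; allFin; downFrom)
open import Data.Nat
open import Data.Nat.DivMod
open import Data.Nat.Properties
open import Data.Nat.Tactic.RingSolver using (solve-∀)
open import Data.Product using (_×_; _,_; proj₁; proj₂; ∃-syntax)
open import Data.Vec as V using (Vec; []; _∷_; lookup)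
open import Function.Base using (_∘_)
open import Function.Bundles using (Equivalence)
open import Relation.Binary.PropositionalEquality
open import Relation.Nullary using (yes; no; contradiction)

𝟙 : Bool → ℕ
𝟙 true  = 1
𝟙 false = 0

∑ : {A : Set} → List A → (A → ℕ) → ℕ
∑ []       f = 0
∑ (x ∷ xs) f = f x + ∑ xs f

+-interchange : ∀ a b c d → (a + b) + (c + d) ≡ (a + c) + (b + d)
+-interchange = solve-∀

∑-++ : {A : Set} (xs ys : List A) (f : A → ℕ) → ∑ (xs ++ ys) f ≡ ∑ xs f + ∑ ys f
∑-++ []       ys f = refl
∑-++ (x ∷ xs) ys f = trans (cong (f x +_) (∑-++ xs ys f)) (sym (+-assoc (f x) _ _))

∑-concatMap : {A B : Set} (g : A → List B) (xs : List A) (f : B → ℕ) →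
              ∑ (concatMap g xs) f ≡ ∑ xs (λ x → ∑ (g x) f)
∑-concatMap g []       f = refl
∑-concatMap g (x ∷ xs) f =
  trans (∑-++ (g x) (concatMap g xs) f) (cong (∑ (g x) f +_) (∑-concatMap g xs f))

∑-map : {A B : Set} (g : A → B) (xs : List A) (f : B → ℕ) → ∑ (L.map g xs) f ≡ ∑ xs (λ x → f (g x))
∑-map g []       f = refl
∑-map g (x ∷ xs) f = cong (f (g x) +_) (∑-map g xs f)

∑-cong : {A : Set} (xs : List A) {f g : A → ℕ} → (∀ x → f x ≡ g x) → ∑ xs f ≡ ∑ xs g
∑-cong []       f≡g = refl
∑-cong (x ∷ xs) f≡g = cong₂ _+_ (f≡g x) (∑-cong xs f≡g)

∑-mono : {A : Set} (xs : List A) {f g : A → ℕ} → (∀ x → f x ≤ g x) → ∑ xs f ≤ ∑ xs g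
∑-mono []       f≤g = z≤n
∑-mono (x ∷ xs) f≤g = +-mono-≤ (f≤g x) (∑-mono xs f≤g)

∑-zero : {A : Set} (xs : List A) {f : A → ℕ} → (∀ x → f x ≡ 0) → ∑ xs f ≡ 0
∑-zero []       f≡0 = refl
∑-zero (x ∷ xs) {f} f≡0 = trans (cong (_+ ∑ xs f) (f≡0 x)) (∑-zero xs f≡0)

∑-+ : {A : Set} (xs : List A) (f g : A → ℕ) → ∑ xs (λ x → f x + g x) ≡ ∑ xs f + ∑ xs g
∑-+ []       f g = refl
∑-+ (x ∷ xs) f g =
  trans (cong ((f x + g x) +_) (∑-+ xs f g)) (+-interchange (f x) (g x) (∑ xs f) (∑ xs g))

∑-*ˡ : {A : Set} (c : ℕ) (xs : List A) (f : A → ℕ) → ∑ xs (λ x → c * f x) ≡ c * ∑ xs f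
∑-*ˡ c []       f = sym (*-zeroʳ c)
∑-*ˡ c (x ∷ xs) f = trans (cong (c * f x +_) (∑-*ˡ c xs f)) (sym (*-distribˡ-+ c (f x) _))

∑-*ʳ : {A : Set} (c : ℕ) (xs : List A) (f : A → ℕ) → ∑ xs (λ x → f x * c) ≡ ∑ xs f * c
∑-*ʳ c xs f = trans (∑-cong xs (λ x → *-comm (f x) c)) (trans (∑-*ˡ c xs f) (*-comm c _))

∑-swap : {A B : Set} (xs : List A) (ys : List B) (f : A → B → ℕ) →
         ∑ xs (λ x → ∑ ys (f x)) ≡ ∑ ys (λ y → ∑ xs (λ x → f x y))
∑-swap []       ys f = sym (∑-zero ys (λ _ → refl))
∑-swap (x ∷ xs) ys f =
  trans (cong (∑ ys (f x) +_) (∑-swap xs ys f)) (sym (∑-+ ys (f x) (λ y → ∑ xs (λ x′ → f x′ y))))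

∑ᶠ : (n : ℕ) → (Fin n → ℕ) → ℕ
∑ᶠ zero    F = 0
∑ᶠ (suc n) F = F zero + ∑ᶠ n (λ i → F (suc i))

∏ᶠ : (n : ℕ) → (Fin n → ℕ) → ℕ
∏ᶠ zero    F = 1
∏ᶠ (suc n) F = F zero * ∏ᶠ n (λ i → F (suc i))

∑-tabulate : {A : Set} {n : ℕ} (g : Fin n → A) (f : A → ℕ) → ∑ (L.tabulate g) f ≡ ∑ᶠ n (λ i → f (g i))
∑-tabulate {n = zero}  g f = refl
∑-tabulate {n = suc n} g f = cong (f (g zero) +_) (∑-tabulate (λ i → g (suc i)) f)

∑-allFin : (n : ℕ) (f : Fin n → ℕ) → ∑ (allFin n) f ≡ ∑ᶠ n f
∑-allFin n f = ∑-tabulate {n = n} (λ i → i) f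

∑ᶠ-cong : (n : ℕ) {F G : Fin n → ℕ} → (∀ i → F i ≡ G i) → ∑ᶠ n F ≡ ∑ᶠ n G
∑ᶠ-cong zero    F≡G = refl
∑ᶠ-cong (suc n) F≡G = cong₂ _+_ (F≡G zero) (∑ᶠ-cong n (λ i → F≡G (suc i)))

∑ᶠ-mono : (n : ℕ) {F G : Fin n → ℕ} → (∀ i → F i ≤ G i) → ∑ᶠ n F ≤ ∑ᶠ n G
∑ᶠ-mono zero    F≤G = z≤n
∑ᶠ-mono (suc n) F≤G = +-mono-≤ (F≤G zero) (∑ᶠ-mono n (λ i → F≤G (suc i)))

∑ᶠ-+ : (n : ℕ) (F G : Fin n → ℕ) → ∑ᶠ n (λ i → F i + G i) ≡ ∑ᶠ n F + ∑ᶠ n G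
∑ᶠ-+ zero    F G = refl
∑ᶠ-+ (suc n) F G = trans (cong ((F zero + G zero) +_) (∑ᶠ-+ n _ _)) (+-interchange (F zero) (G zero) _ _)

∑ᶠ-const-1 : ∀ n → ∑ᶠ n (λ _ → 1) ≡ n
∑ᶠ-const-1 zero    = refl
∑ᶠ-const-1 (suc n) = cong suc (∑ᶠ-const-1 n)

∏ᶠ-cong : (n : ℕ) {F G : Fin n → ℕ} → (∀ i → F i ≡ G i) → ∏ᶠ n F ≡ ∏ᶠ n G
∏ᶠ-cong zero    F≡G = refl
∏ᶠ-cong (suc n) F≡G = cong₂ _*_ (F≡G zero) (∏ᶠ-cong n (λ i → F≡G (suc i)))

∏ᶠ-* : (n : ℕ) (F G : Fin n → ℕ) → ∏ᶠ n F * ∏ᶠ n G ≡ ∏ᶠ n (λ i → F i * G i)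
∏ᶠ-* zero    F G = refl
∏ᶠ-* (suc n) F G = trans (interchange (F zero) (G zero) _ _) (cong ((F zero * G zero) *_) (∏ᶠ-* n _ _))
  where
  interchange : ∀ a b c d → (a * c) * (b * d) ≡ (a * b) * (c * d)
  interchange = solve-∀

∏ᶠ-const : (n c : ℕ) → ∏ᶠ n (λ _ → c) ≡ c ^ n
∏ᶠ-const zero    c = refl
∏ᶠ-const (suc n) c = cong (c *_) (∏ᶠ-const n c)

^-∑ᶠ : (c n : ℕ) (F : Fin n → ℕ) → c ^ ∑ᶠ n F ≡ ∏ᶠ n (λ i → c ^ F i)
^-∑ᶠ c zero    F = refl
^-∑ᶠ c (suc n) F = trans (^-distribˡ-+-* c (F zero) _) (cong (c ^ F zero *_) (^-∑ᶠ c n _))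

∏ᶠ-last : (n : ℕ) (F : Fin (suc n) → ℕ) → ∏ᶠ (suc n) F ≡ ∏ᶠ n (λ j → F (inject₁ j)) * F (fromℕ n)
∏ᶠ-last zero    F = trans (*-identityʳ (F zero)) (sym (+-identityʳ (F zero)))
∏ᶠ-last (suc n) F = trans (cong (F zero *_) (∏ᶠ-last n (λ i → F (suc i)))) (sym (*-assoc (F zero) _ _))

∏ᵛ : {A : Set} {k : ℕ} → Vec A k → (A → ℕ) → ℕ
∏ᵛ []      g = 1
∏ᵛ (x ∷ v) g = g x * ∏ᵛ v g

∏ᵛ-const-1 : {A : Set} {k : ℕ} (v : Vec A k) → ∏ᵛ v (λ _ → 1) ≡ 1
∏ᵛ-const-1 []      = refl
∏ᵛ-const-1 (x ∷ v) = trans (+-identityʳ _) (∏ᵛ-const-1 v)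

∑-vecs-∏ᵛ : {A : Set} (xs : List A) (k : ℕ) (g : A → ℕ) → ∑ (vecs xs k) (λ v → ∏ᵛ v g) ≡ ∑ xs g ^ k
∑-vecs-∏ᵛ xs zero    g = refl
∑-vecs-∏ᵛ xs (suc k) g = begin
  ∑ (vecs xs (suc k)) (λ v → ∏ᵛ v g)
    ≡⟨ ∑-concatMap (λ x → L.map (x ∷_) (vecs xs k)) xs (λ v → ∏ᵛ v g) ⟩
  ∑ xs (λ x → ∑ (L.map (x ∷_) (vecs xs k)) (λ v → ∏ᵛ v g))
    ≡⟨ ∑-cong xs (λ x → trans (∑-map (x ∷_) (vecs xs k) (λ v → ∏ᵛ v g)) (∑-*ˡ (g x) (vecs xs k) (λ v → ∏ᵛ v g))) ⟩
  ∑ xs (λ x → g x * ∑ (vecs xs k) (λ v → ∏ᵛ v g))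
    ≡⟨ ∑-*ʳ _ xs g ⟩
  ∑ xs g * ∑ (vecs xs k) (λ v → ∏ᵛ v g)
    ≡⟨ cong (∑ xs g *_) (∑-vecs-∏ᵛ xs k g) ⟩
  ∑ xs g * ∑ xs g ^ k ∎
  where open ≡-Reasoning

^-distribʳ-* : ∀ x y m → (x * y) ^ m ≡ x ^ m * y ^ m
^-distribʳ-* x y zero    = refl
^-distribʳ-* x y (suc m) = trans (cong ((x * y) *_) (^-distribʳ-* x y m)) (interchange x y (x ^ m) (y ^ m))
  where
  interchange : ∀ x y a b → x * y * (a * b) ≡ x * a * (y * b)
  interchange = solve-∀

n≤2^n : ∀ n → n ≤ 2 ^ n
n≤2^n zero    = z≤n
n≤2^n (suc n) = ≤-trans (+-mono-≤ (^-monoʳ-≤ 2 {0} {n} z≤n) (n≤2^n n)) (≤-reflexive (double (2 ^ n)))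
  where
  double : ∀ x → x + x ≡ 2 * x
  double = solve-∀

countL≡∑𝟙 : {A : Set} (p : A → Bool) (xs : List A) → countL p xs ≡ ∑ xs (λ x → 𝟙 (p x))
countL≡∑𝟙 p []       = refl
countL≡∑𝟙 p (x ∷ xs) with p x
... | true  = cong suc (countL≡∑𝟙 p xs)
... | false = countL≡∑𝟙 p xs

countL-allFin : {n : ℕ} (p : Fin n → Bool) → countL p (allFin n) ≡ ∑ᶠ n (λ i → 𝟙 (p i))
countL-allFin {n} p = trans (countL≡∑𝟙 p (allFin n)) (∑-allFin n (λ i → 𝟙 (p i)))

countL-none : {A : Set} (p : A → Bool) (xs : List A) → (∀ x → p x ≡ false) → countL p xs ≡ 0
countL-none p []       none = refl
countL-none p (x ∷ xs) none with p x | none x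
... | false | _ = countL-none p xs none

countL*≤∑ : {A : Set} (p : A → Bool) (xs : List A) (K : ℕ) (f : A → ℕ) →
            (∀ x → T (p x) → K ≤ f x) → countL p xs * K ≤ ∑ xs f
countL*≤∑ p []       K f K≤f = z≤n
countL*≤∑ p (x ∷ xs) K f K≤f with p x in eq
... | true  = +-mono-≤ (K≤f x (Equivalence.from T-≡ eq)) (countL*≤∑ p xs K f K≤f)
... | false = ≤-trans (countL*≤∑ p xs K f K≤f) (m≤n+m _ (f x))

𝟙-any≤∑ : {A : Set} (p : A → Bool) (xs : List A) → 𝟙 (BL.any p xs) ≤ ∑ xs (λ x → 𝟙 (p x))
𝟙-any≤∑ p []       = z≤n
𝟙-any≤∑ p (x ∷ xs) = ≤-trans (𝟙-∨ (p x) (BL.any p xs)) (+-monoʳ-≤ (𝟙 (p x)) (𝟙-any≤∑ p xs))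
  where
  𝟙-∨ : ∀ a b → 𝟙 (a ∨ b) ≤ 𝟙 a + 𝟙 b
  𝟙-∨ true  b = s≤s z≤n
  𝟙-∨ false b = ≤-refl

q^countL : {A : Set} {m : ℕ} (q : ℕ) (p : A → Bool) (v : Vec A m) →
           q ^ countL p (V.toList v) ≡ ∏ᵛ v (λ x → q ^ 𝟙 (p x))
q^countL q p []      = refl
q^countL q p (x ∷ v) with p x
... | true  = trans (cong (q *_) (q^countL q p v)) (cong (_* ∏ᵛ v (λ x → q ^ 𝟙 (p x))) (sym (*-identityʳ q)))
... | false = trans (q^countL q p v) (sym (+-identityʳ _))

size≡∑ᶠ : {n : ℕ} (S : Subset n) → size S ≡ ∑ᶠ n (λ i → 𝟙 (lookup S i))
size≡∑ᶠ []      = refl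
size≡∑ᶠ (b ∷ S) =
  trans (countL≡∑𝟙 (λ b → b) (b ∷ V.toList S))
        (cong (𝟙 b +_) (trans (sym (countL≡∑𝟙 (λ b → b) (V.toList S))) (size≡∑ᶠ S)))

size≤n : ∀ {n} (S : Subset n) → size S ≤ n
size≤n {n} S = begin
  size S                         ≡⟨ size≡∑ᶠ S ⟩
  ∑ᶠ n (λ i → 𝟙 (lookup S i))    ≤⟨ ∑ᶠ-mono n (λ i → 𝟙≤1 (lookup S i)) ⟩
  ∑ᶠ n (λ _ → 1)                 ≡⟨ ∑ᶠ-const-1 n ⟩
  n                              ∎
  where
  open ≤-Reasoning
  𝟙≤1 : ∀ b → 𝟙 b ≤ 1
  𝟙≤1 true  = ≤-refl
  𝟙≤1 false = z≤n

-- The number of maximal cyclic intervals of S (0 when S is empty or all of ℤ_n).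
runEnds : {n : ℕ} → Subset n → ℕ
runEnds {n} S = ∑ᶠ n (λ i → 𝟙 (lookup S i ∧ not (lookup S (next i))))

size≡helperInduced+runEnds : {n : ℕ} (S : Subset n) → size S ≡ helperInduced S + runEnds S
size≡helperInduced+runEnds {n} S = begin
  size S
    ≡⟨ size≡∑ᶠ S ⟩
  ∑ᶠ n (λ i → 𝟙 (lookup S i))
    ≡⟨ ∑ᶠ-cong n (λ i → 𝟙-split (lookup S i) (lookup S (next i))) ⟩
  ∑ᶠ n (λ i → 𝟙 (lookup S i ∧ lookup S (next i)) + 𝟙 (lookup S i ∧ not (lookup S (next i))))
    ≡⟨ ∑ᶠ-+ n _ _ ⟩
  ∑ᶠ n (λ i → 𝟙 (lookup S i ∧ lookup S (next i))) + runEnds S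
    ≡⟨ cong (_+ runEnds S) (sym (countL-allFin (λ i → lookup S i ∧ lookup S (next i)))) ⟩
  helperInduced S + runEnds S ∎
  where
  open ≡-Reasoning
  𝟙-split : ∀ a b → 𝟙 a ≡ 𝟙 (a ∧ b) + 𝟙 (a ∧ not b)
  𝟙-split true  true  = refl
  𝟙-split true  false = refl
  𝟙-split false b     = refl

next-inject₁ : {n : ℕ} (j : Fin n) → next {suc n} (inject₁ j) ≡ suc j
next-inject₁ {n} j = toℕ-injective (begin
  toℕ (next (inject₁ j))     ≡⟨ toℕ-fromℕ< _ ⟩
  suc (toℕ (inject₁ j)) % suc n ≡⟨ cong (λ z → suc z % suc n) (toℕ-inject₁ j) ⟩
  suc (toℕ j) % suc n        ≡⟨ m≤n⇒m%n≡m (toℕ<n j) ⟩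
  suc (toℕ j)                ∎)
  where open ≡-Reasoning

next-fromℕ : (n : ℕ) → next {suc n} (fromℕ n) ≡ zero
next-fromℕ n = toℕ-injective (begin
  toℕ (next (fromℕ n))       ≡⟨ toℕ-fromℕ< _ ⟩
  suc (toℕ (fromℕ n)) % suc n ≡⟨ cong (λ z → suc z % suc n) (toℕ-fromℕ n) ⟩
  suc n % suc n              ≡⟨ n%n≡0 (suc n) ⟩
  0                          ∎)
  where open ≡-Reasoning

badSet⇒size+runEnds≤ordinaryInduced :
  ∀ {n k m} ℓ D (es : Outcome n k m) (S : Subset n) → 2 ≤ ℓ → T (badSet ℓ D es S) →
  size S + runEnds S ≤ ordinaryInduced S es
badSet⇒size+runEnds≤ordinaryInduced {n} ℓ@(suc (suc ℓ₂)) D es S (s≤s (s≤s _)) bad =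
  subst (λ t → t + u ≤ o) (sym (size≡helperInduced+runEnds S)) (≤-trans (m≤m+n _ _) h+2u≤o)
  where
  h = helperInduced S
  u = runEnds S
  o = ordinaryInduced S es
  weight-bound : ℓ * size S ≤ inducedWeight ℓ S es
  weight-bound = ≤ᵇ⇒≤ _ _ (proj₂ (Equivalence.to (T-∧ {size S * D <ᵇ n})
                                  (proj₂ (Equivalence.to (T-∧ {0 <ᵇ size S}) bad))))
  -- ℓ(h + u) ≤ (ℓ - 1)h + o, with ℓ(h + u) split so that (ℓ - 1)h cancels
  split : ∀ l h u → suc (suc l) * (h + u) ≡ suc l * h + ((h + u + u) + l * u)
  split = solve-∀
  h+2u≤o : (h + u + u) + ℓ₂ * u ≤ o
  h+2u≤o = +-cancelˡ-≤ (suc ℓ₂ * h) _ _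
             (subst (_≤ suc ℓ₂ * h + o) (split ℓ₂ h u)
               (subst (λ t → ℓ * t ≤ suc ℓ₂ * h + o) (size≡helperInduced+runEnds S) weight-bound))

badAt : (n k m ℓ D : ℕ) → Subset n → ℕ
badAt n k m ℓ D S = countL (λ es → badSet ℓ D es S) (allOutcomes n k m)

badCount≤∑badAt : ∀ n k m ℓ D → badCount n k m ℓ D ≤ ∑ (allSubsets n) (badAt n k m ℓ D)
badCount≤∑badAt n k m ℓ D = begin
  badCount n k m ℓ D
    ≡⟨ countL≡∑𝟙 (badOutcome ℓ D) Ω ⟩
  ∑ Ω (λ es → 𝟙 (badOutcome ℓ D es))
    ≤⟨ ∑-mono Ω (λ es → 𝟙-any≤∑ (badSet ℓ D es) (allSubsets n)) ⟩
  ∑ Ω (λ es → ∑ (allSubsets n) (λ S → 𝟙 (badSet ℓ D es S)))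
    ≡⟨ ∑-swap Ω (allSubsets n) _ ⟩
  ∑ (allSubsets n) (λ S → ∑ Ω (λ es → 𝟙 (badSet ℓ D es S)))
    ≡⟨ ∑-cong (allSubsets n) (λ S → sym (countL≡∑𝟙 _ Ω)) ⟩
  ∑ (allSubsets n) (badAt n k m ℓ D) ∎
  where
  open ≤-Reasoning
  Ω = allOutcomes n k m

badAt-empty : ∀ n k m ℓ D (S : Subset n) → size S ≡ 0 → badAt n k m ℓ D S ≡ 0
badAt-empty n k m ℓ D S |S|≡0 = countL-none _ (allOutcomes n k m) (λ _ → empty-not-bad _ (cong (0 <ᵇ_) |S|≡0))
  where
  empty-not-bad : ∀ c → (0 <ᵇ size S) ≡ false → (0 <ᵇ size S) ∧ c ≡ false
  empty-not-bad c eq rewrite eq = refl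

badAt-large : ∀ n k m ℓ D (S : Subset n) → (size S * D <ᵇ n) ≡ false → badAt n k m ℓ D S ≡ 0
badAt-large n k m ℓ D S eq = countL-none _ (allOutcomes n k m) (λ es → large-not-bad (0 <ᵇ size S) (ℓ * size S ≤ᵇ inducedWeight ℓ S es))
  where
  large-not-bad : ∀ a c → a ∧ ((size S * D <ᵇ n) ∧ c) ≡ false
  large-not-bad a c rewrite eq = ∧-zeroʳ a

-- Exponential moment of the number of induced ordinary edges

𝟙-inducesEdge : {n k : ℕ} (S : Subset n) (e : Edge n k) → 𝟙 (inducesEdge S e) ≡ ∏ᵛ e (λ x → 𝟙 (lookup S x))
𝟙-inducesEdge S []      = refl
𝟙-inducesEdge S (x ∷ e) = trans (𝟙-∧ (lookup S x) (inducesEdge S e)) (cong (𝟙 (lookup S x) *_) (𝟙-inducesEdge S e))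
  where
  𝟙-∧ : ∀ a b → 𝟙 (a ∧ b) ≡ 𝟙 a * 𝟙 b
  𝟙-∧ true  b = sym (+-identityʳ _)
  𝟙-∧ false b = refl

module _ (n k : ℕ) (S : Subset n) (q : ℕ) where

  edges : List (Edge n k)
  edges = vecs (allFin n) k

  edgeMoment : ℕ
  edgeMoment = ∑ edges (λ e → q ^ 𝟙 (inducesEdge S e))

  ∑-edges-1 : ∑ edges (λ _ → 1) ≡ n ^ k
  ∑-edges-1 = begin
    ∑ edges (λ _ → 1)                    ≡⟨ ∑-cong edges (λ e → sym (∏ᵛ-const-1 e)) ⟩
    ∑ edges (λ e → ∏ᵛ e (λ _ → 1))        ≡⟨ ∑-vecs-∏ᵛ (allFin n) k (λ _ → 1) ⟩
    ∑ (allFin n) (λ _ → 1) ^ k            ≡⟨ cong (_^ k) (trans (∑-allFin n (λ _ → 1)) (∑ᶠ-const-1 n)) ⟩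
    n ^ k                                ∎
    where open ≡-Reasoning

  ∑-edges-induced : ∑ edges (λ e → 𝟙 (inducesEdge S e)) ≡ size S ^ k
  ∑-edges-induced = begin
    ∑ edges (λ e → 𝟙 (inducesEdge S e))             ≡⟨ ∑-cong edges (𝟙-inducesEdge S) ⟩
    ∑ edges (λ e → ∏ᵛ e (λ x → 𝟙 (lookup S x)))     ≡⟨ ∑-vecs-∏ᵛ (allFin n) k _ ⟩
    ∑ (allFin n) (λ x → 𝟙 (lookup S x)) ^ k         ≡⟨ cong (_^ k) (trans (∑-allFin n _) (sym (size≡∑ᶠ S))) ⟩
    size S ^ k                                     ∎
    where open ≡-Reasoning

  edgeMoment+size^k : edgeMoment + size S ^ k ≡ n ^ k + q * size S ^ k
  edgeMoment+size^k = begin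
    edgeMoment + size S ^ k
      ≡⟨ cong (edgeMoment +_) (sym ∑-edges-induced) ⟩
    edgeMoment + ∑ edges (λ e → 𝟙 (inducesEdge S e))
      ≡⟨ sym (∑-+ edges _ _) ⟩
    ∑ edges (λ e → q ^ 𝟙 (inducesEdge S e) + 𝟙 (inducesEdge S e))
      ≡⟨ ∑-cong edges (λ e → q^𝟙+𝟙 (inducesEdge S e)) ⟩
    ∑ edges (λ e → 1 + q * 𝟙 (inducesEdge S e))
      ≡⟨ ∑-+ edges _ _ ⟩
    ∑ edges (λ _ → 1) + ∑ edges (λ e → q * 𝟙 (inducesEdge S e))
      ≡⟨ cong₂ _+_ ∑-edges-1 (trans (∑-*ˡ q edges _) (cong (q *_) ∑-edges-induced)) ⟩
    n ^ k + q * size S ^ k ∎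
    where
    open ≡-Reasoning
    q^𝟙+𝟙 : ∀ b → q ^ 𝟙 b + 𝟙 b ≡ 1 + q * 𝟙 b
    q^𝟙+𝟙 true  = trans (cong (_+ 1) (*-identityʳ q)) (trans (+-comm q 1) (cong (1 +_) (sym (*-identityʳ q))))
    q^𝟙+𝟙 false = cong (1 +_) (sym (*-zeroʳ q))

  edgeMoment*q≤ : q * q * size S ^ k ≤ n ^ k → edgeMoment * q ≤ n ^ k * (q + 1)
  edgeMoment*q≤ q²t^k≤n^k = begin
    edgeMoment * q                    ≤⟨ m≤m+n _ _ ⟩
    edgeMoment * q + size S ^ k * q   ≡⟨ sym (*-distribʳ-+ q edgeMoment _) ⟩
    (edgeMoment + size S ^ k) * q     ≡⟨ cong (_* q) edgeMoment+size^k ⟩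
    (n ^ k + q * size S ^ k) * q      ≡⟨ expand (n ^ k) q (size S ^ k) ⟩
    n ^ k * q + q * q * size S ^ k    ≤⟨ +-monoʳ-≤ (n ^ k * q) q²t^k≤n^k ⟩
    n ^ k * q + n ^ k                 ≡⟨ sym (*-suc′ (n ^ k) q) ⟩
    n ^ k * (q + 1)                   ∎
    where
    open ≤-Reasoning
    expand : ∀ N q B → (N + q * B) * q ≡ N * q + q * q * B
    expand = solve-∀
    *-suc′ : ∀ N q → N * (q + 1) ≡ N * q + N
    *-suc′ = solve-∀

  ∑-q^ordinaryInduced : ∀ m → ∑ (allOutcomes n k m) (λ es → q ^ ordinaryInduced S es) ≡ edgeMoment ^ m
  ∑-q^ordinaryInduced m =
    trans (∑-cong (allOutcomes n k m) (q^countL q (inducesEdge S))) (∑-vecs-∏ᵛ edges m _)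

badAt-moment-bound : ∀ n k m ℓ D q .{{_ : NonZero q}} (S : Subset n) → 2 ≤ ℓ → q * q * size S ^ k ≤ n ^ k →
  badAt n k m ℓ D S * q ^ (size S + runEnds S) * q ^ m ≤ (n ^ k) ^ m * (q + 1) ^ m
badAt-moment-bound n k m ℓ D q S 2≤ℓ q²t^k≤n^k = begin
  badAt n k m ℓ D S * q ^ (size S + runEnds S) * q ^ m
    ≤⟨ *-monoˡ-≤ (q ^ m) (countL*≤∑ _ (allOutcomes n k m) _ _
                           (λ es bad → ^-monoʳ-≤ q (badSet⇒size+runEnds≤ordinaryInduced ℓ D es S 2≤ℓ bad))) ⟩
  ∑ (allOutcomes n k m) (λ es → q ^ ordinaryInduced S es) * q ^ m
    ≡⟨ cong (_* q ^ m) (∑-q^ordinaryInduced n k S q m) ⟩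
  edgeMoment n k S q ^ m * q ^ m
    ≡⟨ sym (^-distribʳ-* _ q m) ⟩
  (edgeMoment n k S q * q) ^ m
    ≤⟨ ^-monoˡ-≤ m (edgeMoment*q≤ n k S q q²t^k≤n^k) ⟩
  (n ^ k * (q + 1)) ^ m
    ≡⟨ ^-distribʳ-* _ _ m ⟩
  (n ^ k) ^ m * (q + 1) ^ m ∎
  where open ≤-Reasoning

-- Transfer matrix around the cycle

arc : ℕ → Bool → Bool → ℕ
arc q false y     = 2 * q
arc q true  false = 1
arc q true  true  = q

cycleWeight : {n : ℕ} → ℕ → Subset n → ℕ
cycleWeight {n} q S = ∏ᶠ n (λ i → arc q (lookup S i) (lookup S (next i)))

-- arc q x y · 2^[x] · q^[x ∧ ¬y] = 2q, so cycleWeight q S = (2q)^n / (2^|S| q^(runEnds S)).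
cycleWeight-identity : {n : ℕ} (q : ℕ) (S : Subset n) → cycleWeight q S * 2 ^ size S * q ^ runEnds S ≡ (2 * q) ^ n
cycleWeight-identity {n} q S = begin
  cycleWeight q S * 2 ^ size S * q ^ runEnds S
    ≡⟨ cong₂ (λ u v → cycleWeight q S * u * v) (trans (cong (2 ^_) (size≡∑ᶠ S)) (^-∑ᶠ 2 n _)) (^-∑ᶠ q n _) ⟩
  cycleWeight q S * ∏ᶠ n (λ i → 2 ^ 𝟙 (x i)) * ∏ᶠ n (λ i → q ^ 𝟙 (x i ∧ not (y i)))
    ≡⟨ cong (_* ∏ᶠ n (λ i → q ^ 𝟙 (x i ∧ not (y i)))) (∏ᶠ-* n _ _) ⟩
  ∏ᶠ n (λ i → arc q (x i) (y i) * 2 ^ 𝟙 (x i)) * ∏ᶠ n (λ i → q ^ 𝟙 (x i ∧ not (y i)))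
    ≡⟨ ∏ᶠ-* n _ _ ⟩
  ∏ᶠ n (λ i → arc q (x i) (y i) * 2 ^ 𝟙 (x i) * q ^ 𝟙 (x i ∧ not (y i)))
    ≡⟨ ∏ᶠ-cong n (λ i → arc-weighted (x i) (y i)) ⟩
  ∏ᶠ n (λ _ → 2 * q)
    ≡⟨ ∏ᶠ-const n (2 * q) ⟩
  (2 * q) ^ n ∎
  where
  open ≡-Reasoning
  x y : Fin n → Bool
  x i = lookup S i
  y i = lookup S (next i)
  arc-weighted : ∀ a b → arc q a b * 2 ^ 𝟙 a * q ^ 𝟙 (a ∧ not b) ≡ 2 * q
  arc-weighted false b     = trans (*-identityʳ _) (*-identityʳ _)
  arc-weighted true  false = cong (2 *_) (*-identityʳ q)
  arc-weighted true  true  = trans (*-identityʳ _) (trans (cong (q *_) (*-identityʳ 2)) (*-comm q 2))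

pathWeight : {n : ℕ} → ℕ → Bool → Vec Bool n → Bool → ℕ
pathWeight q p []       f = arc q p f
pathWeight q p (x ∷ xs) f = arc q p x * pathWeight q x xs f

∏ᶠ-arcs≡pathWeight : {n : ℕ} (q : ℕ) (p : Bool) (bs : Vec Bool n) (f : Bool) →
  ∏ᶠ n (λ j → arc q (lookup (p ∷ bs) (inject₁ j)) (lookup bs j)) * arc q (lookup (p ∷ bs) (fromℕ n)) f
    ≡ pathWeight q p bs f
∏ᶠ-arcs≡pathWeight q p []       f = +-identityʳ _
∏ᶠ-arcs≡pathWeight q p (x ∷ xs) f = trans (*-assoc (arc q p x) _ _) (cong (arc q p x *_) (∏ᶠ-arcs≡pathWeight q x xs f))

cycleWeight≡pathWeight : {n : ℕ} (q : ℕ) (b : Bool) (bs : Vec Bool n) → cycleWeight q (b ∷ bs) ≡ pathWeight q b bs b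
cycleWeight≡pathWeight {n} q b bs = begin
  cycleWeight q (b ∷ bs)
    ≡⟨ ∏ᶠ-last n (λ i → arc q (S i) (S (next i))) ⟩
  ∏ᶠ n (λ j → arc q (S (inject₁ j)) (S (next (inject₁ j)))) * arc q (S (fromℕ n)) (S (next (fromℕ n)))
    ≡⟨ cong₂ _*_ (∏ᶠ-cong n (λ j → cong (λ i → arc q (S (inject₁ j)) (S i)) (next-inject₁ j)))
                 (cong (λ i → arc q (S (fromℕ n)) (S i)) (next-fromℕ n)) ⟩
  ∏ᶠ n (λ j → arc q (S (inject₁ j)) (lookup bs j)) * arc q (S (fromℕ n)) b
    ≡⟨ ∏ᶠ-arcs≡pathWeight q b bs b ⟩
  pathWeight q b bs b ∎
  where
  open ≡-Reasoning
  S : Fin (suc n) → Bool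
  S = lookup (b ∷ bs)

bits : List Bool
bits = true ∷ false ∷ []

pathSum : (q : ℕ) (p : Bool) (j : ℕ) (f : Bool) → ℕ
pathSum q p j f = ∑ (vecs bits j) (λ bs → pathWeight q p bs f)

pathSum-suc : ∀ q p j f → pathSum q p (suc j) f ≡ arc q p true * pathSum q true j f + (arc q p false * pathSum q false j f + 0)
pathSum-suc q p j f =
  trans (∑-concatMap (λ x → L.map (x ∷_) (vecs bits j)) bits (λ bs → pathWeight q p bs f))
        (cong₂ _+_ (extend true) (cong (_+ 0) (extend false)))
  where
  extend : ∀ x → ∑ (L.map (x ∷_) (vecs bits j)) (λ bs → pathWeight q p bs f) ≡ arc q p x * pathSum q x j f
  extend x = trans (∑-map (x ∷_) (vecs bits j) _) (∑-*ˡ (arc q p x) (vecs bits j) _)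

-- (q, 1) is a super-eigenvector of the transfer matrix for the eigenvalue 2(q + 1).
pathSum-bound : ∀ q c f → pathSum q false 0 f ≤ c * q → pathSum q true 0 f ≤ c → ∀ j →
  pathSum q false j f ≤ c * q * (2 * (q + 1)) ^ j × pathSum q true j f ≤ c * (2 * (q + 1)) ^ j
pathSum-bound q c f F₀ T₀ zero =
  ≤-trans F₀ (≤-reflexive (sym (*-identityʳ _))) , ≤-trans T₀ (≤-reflexive (sym (*-identityʳ _)))
pathSum-bound q c f F₀ T₀ (suc j) with pathSum-bound q c f F₀ T₀ j
... | Fⱼ , Tⱼ = F , T′
  where
  X = (2 * (q + 1)) ^ j
  F : pathSum q false (suc j) f ≤ c * q * (2 * (q + 1) * X)
  F = begin
    pathSum q false (suc j) f                              ≡⟨ pathSum-suc q false j f ⟩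
    2 * q * pathSum q true j f + (2 * q * pathSum q false j f + 0)
      ≤⟨ +-mono-≤ (*-monoʳ-≤ (2 * q) Tⱼ) (+-monoˡ-≤ 0 (*-monoʳ-≤ (2 * q) Fⱼ)) ⟩
    2 * q * (c * X) + (2 * q * (c * q * X) + 0)            ≡⟨ eigen q c X ⟩
    c * q * (2 * (q + 1) * X)                              ∎
    where
    open ≤-Reasoning
    eigen : ∀ q c X → 2 * q * (c * X) + (2 * q * (c * q * X) + 0) ≡ c * q * (2 * (q + 1) * X)
    eigen = solve-∀
  T′ : pathSum q true (suc j) f ≤ c * (2 * (q + 1) * X)
  T′ = begin
    pathSum q true (suc j) f                               ≡⟨ pathSum-suc q true j f ⟩
    q * pathSum q true j f + (1 * pathSum q false j f + 0)
      ≤⟨ +-mono-≤ (*-monoʳ-≤ q Tⱼ) (+-monoˡ-≤ 0 (*-monoʳ-≤ 1 Fⱼ)) ⟩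
    q * (c * X) + (1 * (c * q * X) + 0)                    ≤⟨ m≤m+n _ (2 * c * X) ⟩
    q * (c * X) + (1 * (c * q * X) + 0) + 2 * c * X        ≡⟨ eigen q c X ⟩
    c * (2 * (q + 1) * X)                                  ∎
    where
    open ≤-Reasoning
    eigen : ∀ q c X → q * (c * X) + (1 * (c * q * X) + 0) + 2 * c * X ≡ c * (2 * (q + 1) * X)
    eigen = solve-∀

∑-cycleWeight≤ : ∀ q n → ∑ (allSubsets n) (cycleWeight q) ≤ 2 * (2 * (q + 1)) ^ n
∑-cycleWeight≤ q zero    = s≤s z≤n
∑-cycleWeight≤ q (suc n) = begin
  ∑ (allSubsets (suc n)) (cycleWeight q)
    ≡⟨ ∑-concatMap (λ x → L.map (x ∷_) (vecs bits n)) bits (cycleWeight q) ⟩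
  ∑ (L.map (true ∷_) (vecs bits n)) (cycleWeight q) + (∑ (L.map (false ∷_) (vecs bits n)) (cycleWeight q) + 0)
    ≡⟨ cong₂ (λ u v → u + (v + 0)) (closed true) (closed false) ⟩
  pathSum q true n true + (pathSum q false n false + 0)
    ≤⟨ +-mono-≤ (proj₂ (pathSum-bound q (q + 2) true (≤-trans (≤-reflexive (+-identityʳ _)) (*-monoˡ-≤ q (m≤n+m 2 q)))
                                           (≤-trans (≤-reflexive (+-identityʳ _)) (m≤m+n q 2)) n))
                (+-monoˡ-≤ 0 (proj₁ (pathSum-bound q 2 false (≤-reflexive (+-identityʳ _)) (s≤s z≤n) n))) ⟩
  (q + 2) * X + (2 * q * X + 0)                           ≤⟨ m≤m+n _ (q * X + 2 * X) ⟩
  (q + 2) * X + (2 * q * X + 0) + (q * X + 2 * X)         ≡⟨ collect q X ⟩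
  2 * (2 * (q + 1) * X)                                   ∎
  where
  open ≤-Reasoning
  X = (2 * (q + 1)) ^ n
  closed : ∀ b → ∑ (L.map (b ∷_) (vecs bits n)) (cycleWeight q) ≡ pathSum q b n b
  closed b = trans (∑-map (b ∷_) (vecs bits n) (cycleWeight q)) (∑-cong (vecs bits n) (cycleWeight≡pathWeight q b))
  collect : ∀ q X → (q + 2) * X + (2 * q * X + 0) + (q * X + 2 * X) ≡ 2 * (2 * (q + 1) * X)
  collect = solve-∀

-- (1 + 1/(s+r))^s ≤ 1 + s/r, with the denominators cleared.
[s+r+1]^s*r≤[s+r]^[1+s] : ∀ s r → (s + r + 1) ^ s * r ≤ (s + r) ^ suc s
[s+r+1]^s*r≤[s+r]^[1+s] zero    r = ≤-reflexive (trans (+-identityʳ r) (sym (*-identityʳ r)))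
[s+r+1]^s*r≤[s+r]^[1+s] (suc s) r = begin
  a ^ suc s * r                ≡⟨ trans (cong (_* r) (*-comm a (a ^ s))) (*-assoc (a ^ s) a r) ⟩
  a ^ s * (a * r)              ≤⟨ *-monoʳ-≤ (a ^ s) (≤-trans (m≤m+n _ (suc s)) (≤-reflexive (factor s r))) ⟩
  a ^ s * ((r + 1) * b)        ≡⟨ sym (*-assoc (a ^ s) (r + 1) b) ⟩
  a ^ s * (r + 1) * b          ≤⟨ *-monoˡ-≤ b shifted ⟩
  b ^ suc s * b                ≡⟨ *-comm _ b ⟩
  b ^ suc (suc s)              ∎
  where
  open ≤-Reasoning
  a = suc s + r + 1
  b = suc s + r
  factor : ∀ s r → (suc s + r + 1) * r + suc s ≡ (r + 1) * (suc s + r)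
  factor = solve-∀
  shifted : a ^ s * (r + 1) ≤ b ^ suc s
  shifted = subst₂ (λ x y → x ^ s * (r + 1) ≤ y ^ suc s) (rearrange₁ s r) (rearrange₂ s r) ([s+r+1]^s*r≤[s+r]^[1+s] s (r + 1))
    where
    rearrange₁ : ∀ s r → s + (r + 1) + 1 ≡ suc s + r + 1
    rearrange₁ = solve-∀
    rearrange₂ : ∀ s r → s + (r + 1) ≡ suc s + r
    rearrange₂ = solve-∀

-- (1 + 1/q)^q ≤ (1 + 1/2q)^2q ≤ 4.
[q+1]^q≤4*q^q : ∀ q .{{_ : NonZero q}} → (q + 1) ^ q ≤ 4 * q ^ q
[q+1]^q≤4*q^q q = *-cancelʳ-≤ _ _ (Y * Y) {{m*n≢0 Y Y {{m^n≢0 (q + q) q}} {{m^n≢0 (q + q) q}}}} (begin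
  (q + 1) ^ q * (Y * Y)                 ≡⟨ cong ((q + 1) ^ q *_) (sym (^-distribʳ-* (q + q) (q + q) q)) ⟩
  (q + 1) ^ q * ((q + q) * (q + q)) ^ q ≡⟨ sym (^-distribʳ-* (q + 1) _ q) ⟩
  ((q + 1) * ((q + q) * (q + q))) ^ q   ≤⟨ ^-monoˡ-≤ q halve ⟩
  (q * ((q + q + 1) * (q + q + 1))) ^ q ≡⟨ trans (^-distribʳ-* q _ q) (cong (q ^ q *_) (^-distribʳ-* (q + q + 1) (q + q + 1) q)) ⟩
  q ^ q * (Z * Z)                       ≤⟨ *-monoʳ-≤ (q ^ q) (*-mono-≤ Z≤2Y Z≤2Y) ⟩
  q ^ q * (2 * Y * (2 * Y))             ≡⟨ regroup (q ^ q) Y ⟩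
  4 * q ^ q * (Y * Y)                   ∎)
  where
  open ≤-Reasoning
  instance
    q+q≢0 : NonZero (q + q)
    q+q≢0 = >-nonZero (<-≤-trans (>-nonZero⁻¹ q) (m≤m+n q q))
  Y = (q + q) ^ q
  Z = (q + q + 1) ^ q
  Z≤2Y : Z ≤ 2 * Y
  Z≤2Y = *-cancelʳ-≤ Z (2 * Y) q (≤-trans ([s+r+1]^s*r≤[s+r]^[1+s] q q) (≤-reflexive (double q Y)))
    where
    double : ∀ q Y → (q + q) * Y ≡ 2 * Y * q
    double = solve-∀
  halve : (q + 1) * ((q + q) * (q + q)) ≤ q * ((q + q + 1) * (q + q + 1))
  halve = ≤-trans (m≤m+n _ q) (≤-reflexive (square q))
    where
    square : ∀ q → (q + 1) * ((q + q) * (q + q)) + q ≡ q * ((q + q + 1) * (q + q + 1))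
    square = solve-∀
  regroup : ∀ a Y → a * (2 * Y * (2 * Y)) ≡ 4 * a * (Y * Y)
  regroup = solve-∀

[q+1]^e≤256^t*q^e : ∀ q .{{_ : NonZero q}} t e → e ≤ q * (4 * t) → (q + 1) ^ e ≤ 256 ^ t * q ^ e
[q+1]^e≤256^t*q^e q t e e≤b = *-cancelʳ-≤ _ _ (q ^ b) {{m^n≢0 q b}} (begin
  (q + 1) ^ e * q ^ b                  ≡⟨ cong ((q + 1) ^ e *_) (^-distribˡ-+-* q e r) ⟩
  (q + 1) ^ e * (q ^ e * q ^ r)        ≤⟨ *-monoʳ-≤ ((q + 1) ^ e) (*-monoʳ-≤ (q ^ e) (^-monoˡ-≤ r (m≤m+n q 1))) ⟩
  (q + 1) ^ e * (q ^ e * (q + 1) ^ r)  ≡⟨ regroup₁ ((q + 1) ^ e) (q ^ e) ((q + 1) ^ r) ⟩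
  (q + 1) ^ e * (q + 1) ^ r * q ^ e    ≡⟨ cong (_* q ^ e) (sym (^-distribˡ-+-* (q + 1) e r)) ⟩
  (q + 1) ^ b * q ^ e                  ≤⟨ *-monoˡ-≤ (q ^ e) full ⟩
  256 ^ t * q ^ b * q ^ e              ≡⟨ regroup₂ (256 ^ t) (q ^ b) (q ^ e) ⟩
  256 ^ t * q ^ e * q ^ b              ∎)
  where
  open ≤-Reasoning
  r = q * (4 * t) ∸ e
  b = e + r
  full : (q + 1) ^ b ≤ 256 ^ t * q ^ b
  full = begin
    (q + 1) ^ b                   ≡⟨ cong ((q + 1) ^_) (m+[n∸m]≡n e≤b) ⟩
    (q + 1) ^ (q * (4 * t))       ≡⟨ sym (^-*-assoc (q + 1) q (4 * t)) ⟩
    ((q + 1) ^ q) ^ (4 * t)       ≤⟨ ^-monoˡ-≤ (4 * t) ([q+1]^q≤4*q^q q) ⟩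
    (4 * q ^ q) ^ (4 * t)         ≡⟨ ^-distribʳ-* 4 (q ^ q) (4 * t) ⟩
    4 ^ (4 * t) * (q ^ q) ^ (4 * t) ≡⟨ cong₂ _*_ (sym (^-*-assoc 4 4 t)) (^-*-assoc q q (4 * t)) ⟩
    256 ^ t * q ^ (q * (4 * t))   ≡⟨ cong (λ z → 256 ^ t * q ^ z) (sym (m+[n∸m]≡n e≤b)) ⟩
    256 ^ t * q ^ b               ∎
  regroup₁ : ∀ x y z → x * (y * z) ≡ x * z * y
  regroup₁ = solve-∀
  regroup₂ : ∀ x y z → x * y * z ≡ x * z * y
  regroup₂ = solve-∀

X*q^t≤2*W*512^t : ∀ X W q t n m .{{_ : NonZero q}} →
  X * (q ^ (m + t) * (2 * q) ^ n) ≤ W * (q + 1) ^ m * 2 ^ t * (2 * (2 * (q + 1)) ^ n) →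
  m + n ≤ q * (4 * t) → X * q ^ t ≤ 2 * W * 512 ^ t
X*q^t≤2*W*512^t X W q t n m H m+n≤4qt =
  *-cancelʳ-≤ _ _ (q ^ (m + n) * 2 ^ n) {{m*n≢0 _ _ {{m^n≢0 q (m + n)}} {{m^n≢0 2 n}}}} (begin
    X * q ^ t * (q ^ (m + n) * 2 ^ n)                  ≡⟨ lhs ⟩
    X * (q ^ (m + t) * (2 * q) ^ n)                    ≤⟨ H ⟩
    W * (q + 1) ^ m * 2 ^ t * (2 * (2 * (q + 1)) ^ n)  ≡⟨ rhs ⟩
    2 * W * 2 ^ t * (q + 1) ^ (m + n) * 2 ^ n
      ≤⟨ *-monoˡ-≤ (2 ^ n) (*-monoʳ-≤ (2 * W * 2 ^ t) ([q+1]^e≤256^t*q^e q t (m + n) m+n≤4qt)) ⟩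
    2 * W * 2 ^ t * (256 ^ t * q ^ (m + n)) * 2 ^ n    ≡⟨ final ⟩
    2 * W * 512 ^ t * (q ^ (m + n) * 2 ^ n)            ∎)
  where
  open ≤-Reasoning
  lhs : X * q ^ t * (q ^ (m + n) * 2 ^ n) ≡ X * (q ^ (m + t) * (2 * q) ^ n)
  lhs rewrite ^-distribˡ-+-* q m n | ^-distribˡ-+-* q m t | ^-distribʳ-* 2 q n =
    reorder X (q ^ t) (q ^ m) (q ^ n) (2 ^ n)
    where
    reorder : ∀ X a b c d → X * a * (b * c * d) ≡ X * (b * a * (d * c))
    reorder = solve-∀
  rhs : W * (q + 1) ^ m * 2 ^ t * (2 * (2 * (q + 1)) ^ n) ≡ 2 * W * 2 ^ t * (q + 1) ^ (m + n) * 2 ^ n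
  rhs rewrite ^-distribʳ-* 2 (q + 1) n | ^-distribˡ-+-* (q + 1) m n =
    reorder W ((q + 1) ^ m) (2 ^ t) (2 ^ n) ((q + 1) ^ n)
    where
    reorder : ∀ W a b c d → W * a * b * (2 * (c * d)) ≡ 2 * W * b * (a * d) * c
    reorder = solve-∀
  final : 2 * W * 2 ^ t * (256 ^ t * q ^ (m + n)) * 2 ^ n ≡ 2 * W * 512 ^ t * (q ^ (m + n) * 2 ^ n)
  final = trans (reorder (2 * W) (2 ^ t) (256 ^ t) (q ^ (m + n)) (2 ^ n))
                (cong (λ z → 2 * W * z * (q ^ (m + n) * 2 ^ n)) (sym (^-distribʳ-* 2 256 t)))
    where
    reorder : ∀ W a b c d → W * a * (b * c) * d ≡ W * (a * b) * (c * d)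
    reorder = solve-∀

X*n*2^t≤8192*W : ∀ X W q t′ n → n ≤ q * (2 * suc t′) → 4096 * suc t′ ≤ n →
  X * q ^ suc t′ ≤ 2 * W * 512 ^ suc t′ → X * n * 2 ^ suc t′ ≤ 8192 * W
X*n*2^t≤8192*W X W q t′ n n≤2qt 4096t≤n Xq^t≤ = *-cancelʳ-≤ _ _ (2 ^ t) {{m^n≢0 2 t}} (begin
  X * n * 2 ^ t * 2 ^ t    ≡⟨ trans (*-assoc (X * n) (2 ^ t) (2 ^ t)) (cong (X * n *_) (sym (^-distribʳ-* 2 2 t))) ⟩
  X * n * 4 ^ t            ≤⟨ X*n*4^t≤ ⟩
  8192 * W * t             ≤⟨ *-monoʳ-≤ (8192 * W) (n≤2^n t) ⟩
  8192 * W * 2 ^ t         ∎)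
  where
  open ≤-Reasoning
  t = suc t′
  instance
    n≢0 : NonZero n
    n≢0 = >-nonZero (≤-trans (s≤s z≤n) 4096t≤n)
  X*n*4^t≤ : X * n * 4 ^ t ≤ 8192 * W * t
  X*n*4^t≤ = *-cancelʳ-≤ _ _ (n ^ t′) {{m^n≢0 n t′}} (begin
    X * n * 4 ^ t * n ^ t′                  ≡⟨ reorder₁ X n (4 ^ t) (n ^ t′) ⟩
    X * n ^ t * 4 ^ t                       ≤⟨ *-monoˡ-≤ (4 ^ t) (*-monoʳ-≤ X (^-monoˡ-≤ t n≤2qt)) ⟩
    X * (q * (2 * t)) ^ t * 4 ^ t           ≡⟨ cong (λ z → X * z * 4 ^ t) (^-distribʳ-* q (2 * t) t) ⟩
    X * (q ^ t * (2 * t) ^ t) * 4 ^ t       ≡⟨ reorder₂ X (q ^ t) ((2 * t) ^ t) (4 ^ t) ⟩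
    X * q ^ t * ((2 * t) ^ t * 4 ^ t)       ≤⟨ *-monoˡ-≤ _ Xq^t≤ ⟩
    2 * W * 512 ^ t * ((2 * t) ^ t * 4 ^ t) ≡⟨ *-assoc (2 * W) (512 ^ t) _ ⟩
    2 * W * (512 ^ t * ((2 * t) ^ t * 4 ^ t)) ≡⟨ cong (2 * W *_) merge ⟩
    2 * W * (4096 * t * (4096 * t) ^ t′)    ≤⟨ *-monoʳ-≤ (2 * W) (*-monoʳ-≤ (4096 * t) (^-monoˡ-≤ t′ 4096t≤n)) ⟩
    2 * W * (4096 * t * n ^ t′)             ≡⟨ reorder₃ W t (n ^ t′) ⟩
    8192 * W * t * n ^ t′                   ∎)
    where
    merge : 512 ^ t * ((2 * t) ^ t * 4 ^ t) ≡ (4096 * t) ^ t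
    merge = begin-equality
      512 ^ t * ((2 * t) ^ t * 4 ^ t)   ≡⟨ cong (512 ^ t *_) (sym (^-distribʳ-* (2 * t) 4 t)) ⟩
      512 ^ t * (2 * t * 4) ^ t         ≡⟨ sym (^-distribʳ-* 512 (2 * t * 4) t) ⟩
      (512 * (2 * t * 4)) ^ t           ≡⟨ cong (_^ t) (constants t) ⟩
      (4096 * t) ^ t                    ∎
      where
      constants : ∀ t → 512 * (2 * t * 4) ≡ 4096 * t
      constants = solve-∀
    reorder₁ : ∀ X n a b → X * n * a * b ≡ X * (n * b) * a
    reorder₁ = solve-∀
    reorder₂ : ∀ X a b c → X * (a * b) * c ≡ X * a * (b * c)
    reorder₂ = solve-∀
    reorder₃ : ∀ W t a → 2 * W * (4096 * t * a) ≡ 8192 * W * t * a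
    reorder₃ = solve-∀

-- Sorting the bad sets by size

δ : ℕ → ℕ → ℕ
δ zero    zero    = 1
δ zero    (suc _) = 0
δ (suc _) zero    = 0
δ (suc s) (suc t) = δ s t

δ-refl : ∀ s → δ s s ≡ 1
δ-refl zero    = refl
δ-refl (suc s) = δ-refl s

δ-≢ : ∀ {s t} → s ≢ t → δ s t ≡ 0
δ-≢ {zero}  {zero}  s≢t = contradiction refl s≢t
δ-≢ {zero}  {suc t} s≢t = refl
δ-≢ {suc s} {zero}  s≢t = refl
δ-≢ {suc s} {suc t} s≢t = δ-≢ (s≢t ∘ cong suc)

1≤∑δ : ∀ {s} T → s < T → 1 ≤ ∑ (downFrom T) (δ s)
1≤∑δ {s} (suc T) s<1+T with s ≟ T
... | yes refl = ≤-trans (≤-reflexive (sym (δ-refl s))) (m≤m+n _ _)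
... | no s≢T   = ≤-trans (1≤∑δ T (≤∧≢⇒< (s≤s⁻¹ s<1+T) s≢T)) (m≤n+m _ _)

sizeClass : (n k m ℓ D t : ℕ) → ℕ
sizeClass n k m ℓ D t = ∑ (allSubsets n) (λ S → δ (size S) t * badAt n k m ℓ D S)

badCount≤∑sizeClass : ∀ n k m ℓ D → badCount n k m ℓ D ≤ ∑ (downFrom n) (λ t′ → sizeClass n k m ℓ D (suc t′))
badCount≤∑sizeClass n k m ℓ D = begin
  badCount n k m ℓ D
    ≤⟨ badCount≤∑badAt n k m ℓ D ⟩
  ∑ (allSubsets n) (badAt n k m ℓ D)
    ≤⟨ ∑-mono (allSubsets n) byClass ⟩
  ∑ (allSubsets n) (λ S → ∑ (downFrom n) (λ t′ → δ (size S) (suc t′) * badAt n k m ℓ D S))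
    ≡⟨ ∑-swap (allSubsets n) (downFrom n) _ ⟩
  ∑ (downFrom n) (λ t′ → sizeClass n k m ℓ D (suc t′)) ∎
  where
  open ≤-Reasoning
  byClass : ∀ S → badAt n k m ℓ D S ≤ ∑ (downFrom n) (λ t′ → δ (size S) (suc t′) * badAt n k m ℓ D S)
  byClass S = byClass′ (size S) refl
    where
    byClass′ : ∀ s → size S ≡ s → badAt n k m ℓ D S ≤ ∑ (downFrom n) (λ t′ → δ s (suc t′) * badAt n k m ℓ D S)
    byClass′ zero    |S|≡0 =
      ≤-reflexive (trans (badAt-empty n k m ℓ D S |S|≡0) (sym (∑-zero (downFrom n) (λ _ → refl))))
    byClass′ (suc s) |S|≡1+s = begin
      badAt n k m ℓ D S                                   ≤⟨ m≤n*m _ (∑ (downFrom n) (δ s)) {{>-nonZero (1≤∑δ n s<n)}} ⟩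
      ∑ (downFrom n) (δ s) * badAt n k m ℓ D S             ≡⟨ sym (∑-*ʳ _ (downFrom n) (δ s)) ⟩
      ∑ (downFrom n) (λ t′ → δ s t′ * badAt n k m ℓ D S)  ∎
      where
      s<n : s < n
      s<n = subst (_≤ n) |S|≡1+s (size≤n S)

sizeClass-large : ∀ n k m ℓ D t → (t * D <ᵇ n) ≡ false → sizeClass n k m ℓ D t ≡ 0
sizeClass-large n k m ℓ D t large = ∑-zero (allSubsets n) term≡0
  where
  term≡0 : ∀ S → δ (size S) t * badAt n k m ℓ D S ≡ 0
  term≡0 S with size S ≟ t
  ... | yes |S|≡t = trans (cong (δ (size S) t *_) (badAt-large n k m ℓ D S (trans (cong (λ z → z * D <ᵇ n) |S|≡t) large)))
                          (*-zeroʳ (δ (size S) t))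
  ... | no  |S|≢t = cong (_* badAt n k m ℓ D S) (δ-≢ |S|≢t)

badAt-weighted : ∀ n k m ℓ D q .{{_ : NonZero q}} (S : Subset n) → 2 ≤ ℓ → q * q * size S ^ k ≤ n ^ k →
  badAt n k m ℓ D S * (q ^ (m + size S) * (2 * q) ^ n) ≤ (n ^ k) ^ m * (q + 1) ^ m * 2 ^ size S * cycleWeight q S
badAt-weighted n k m ℓ D q S 2≤ℓ q²t^k≤n^k = begin
  C * (q ^ (m + t) * (2 * q) ^ n)
    ≡⟨ cong (λ z → C * (q ^ (m + t) * z)) (sym (cycleWeight-identity q S)) ⟩
  C * (q ^ (m + t) * (w * 2 ^ t * q ^ u))
    ≡⟨ regroup ⟩
  C * q ^ (t + u) * q ^ m * (w * 2 ^ t)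
    ≤⟨ *-monoˡ-≤ _ (badAt-moment-bound n k m ℓ D q S 2≤ℓ q²t^k≤n^k) ⟩
  (n ^ k) ^ m * (q + 1) ^ m * (w * 2 ^ t)
    ≡⟨ reorder ((n ^ k) ^ m * (q + 1) ^ m) w (2 ^ t) ⟩
  (n ^ k) ^ m * (q + 1) ^ m * 2 ^ t * w ∎
  where
  open ≤-Reasoning
  C = badAt n k m ℓ D S
  t = size S
  u = runEnds S
  w = cycleWeight q S
  regroup : C * (q ^ (m + t) * (w * 2 ^ t * q ^ u)) ≡ C * q ^ (t + u) * q ^ m * (w * 2 ^ t)
  regroup rewrite ^-distribˡ-+-* q m t | ^-distribˡ-+-* q t u = shuffle C (q ^ m) (q ^ t) w (2 ^ t) (q ^ u)
    where
    shuffle : ∀ C a b w c d → C * (a * b * (w * c * d)) ≡ C * (b * d) * a * (w * c)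
    shuffle = solve-∀
  reorder : ∀ R w c → R * (w * c) ≡ R * c * w
  reorder = solve-∀

δ*badAt-weighted : ∀ n k m ℓ D q .{{_ : NonZero q}} t (S : Subset n) → 2 ≤ ℓ → q * q * t ^ k ≤ n ^ k →
  δ (size S) t * badAt n k m ℓ D S * (q ^ (m + t) * (2 * q) ^ n) ≤ (n ^ k) ^ m * (q + 1) ^ m * 2 ^ t * cycleWeight q S
δ*badAt-weighted n k m ℓ D q t S 2≤ℓ q²t^k≤n^k with size S ≟ t
... | no |S|≢t rewrite δ-≢ |S|≢t = z≤n
... | yes refl rewrite δ-refl (size S) =
  ≤-trans (≤-reflexive (cong (_* (q ^ (m + size S) * (2 * q) ^ n)) (*-identityˡ (badAt n k m ℓ D S))))
          (badAt-weighted n k m ℓ D q S 2≤ℓ q²t^k≤n^k)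

sizeClass-weighted : ∀ n k m ℓ D q .{{_ : NonZero q}} t → 2 ≤ ℓ → q * q * t ^ k ≤ n ^ k →
  sizeClass n k m ℓ D t * (q ^ (m + t) * (2 * q) ^ n) ≤ (n ^ k) ^ m * (q + 1) ^ m * 2 ^ t * (2 * (2 * (q + 1)) ^ n)
sizeClass-weighted n k m ℓ D q t 2≤ℓ q²t^k≤n^k = begin
  sizeClass n k m ℓ D t * K                                 ≡⟨ sym (∑-*ʳ K (allSubsets n) _) ⟩
  ∑ (allSubsets n) (λ S → δ (size S) t * badAt n k m ℓ D S * K)
    ≤⟨ ∑-mono (allSubsets n) (λ S → δ*badAt-weighted n k m ℓ D q t S 2≤ℓ q²t^k≤n^k) ⟩
  ∑ (allSubsets n) (λ S → R * cycleWeight q S)              ≡⟨ ∑-*ˡ R (allSubsets n) (cycleWeight q) ⟩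
  R * ∑ (allSubsets n) (cycleWeight q)                      ≤⟨ *-monoʳ-≤ R (∑-cycleWeight≤ q n) ⟩
  R * (2 * (2 * (q + 1)) ^ n)                               ∎
  where
  open ≤-Reasoning
  K = q ^ (m + t) * (2 * q) ^ n
  R = (n ^ k) ^ m * (q + 1) ^ m * 2 ^ t

q*q*t^k≤n^k : ∀ q t n k → 2 ≤ k → q * t ≤ n → t ≤ n → q * q * t ^ k ≤ n ^ k
q*q*t^k≤n^k q t n (suc (suc k)) (s≤s (s≤s _)) qt≤n t≤n = begin
  q * q * (t * (t * t ^ k))        ≡⟨ pair q t (t ^ k) ⟩
  q * t * (q * t * t ^ k)          ≤⟨ *-mono-≤ qt≤n (*-mono-≤ qt≤n (^-monoˡ-≤ k t≤n)) ⟩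
  n * (n * n ^ k)                  ∎
  where
  open ≤-Reasoning
  pair : ∀ q t a → q * q * (t * (t * a)) ≡ q * t * (q * t * a)
  pair = solve-∀

n≤n/t*[2*t] : ∀ n t .{{_ : NonZero t}} → t ≤ n → n ≤ n / t * (2 * t)
n≤n/t*[2*t] n t t≤n = begin
  n                        ≡⟨ m≡m%n+[m/n]*n n t ⟩
  n % t + n / t * t        ≤⟨ +-monoˡ-≤ (n / t * t) (<⇒≤ (m%n<n n t)) ⟩
  t + n / t * t            ≤⟨ +-monoˡ-≤ (n / t * t) (m≤n*m t (n / t) {{>-nonZero (m≥n⇒m/n>0 t≤n)}}) ⟩
  n / t * t + n / t * t    ≡⟨ double (n / t) t ⟩
  n / t * (2 * t)          ∎
  where
  open ≤-Reasoning
  double : ∀ q t → q * t + q * t ≡ q * (2 * t)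
  double = solve-∀

sizeClass-bound : ∀ n k m ℓ t′ → 2 ≤ k → 2 ≤ ℓ → m ≤ n →
  sizeClass n k m ℓ 4096 (suc t′) * n * 2 ^ suc t′ ≤ 8192 * (n ^ k) ^ m
sizeClass-bound n k m ℓ t′ 2≤k 2≤ℓ m≤n with suc t′ * 4096 <ᵇ n in small
... | false = subst (λ X → X * n * 2 ^ suc t′ ≤ 8192 * (n ^ k) ^ m) (sym (sizeClass-large n k m ℓ 4096 (suc t′) small)) z≤n
... | true  = X*n*2^t≤8192*W X W q t′ n n≤2qt 4096t≤n
                (X*q^t≤2*W*512^t X W q t n m
                  (sizeClass-weighted n k m ℓ 4096 q t 2≤ℓ (q*q*t^k≤n^k q t n k 2≤k (m/n*n≤m n t) t≤n))
                  m+n≤4qt)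
  where
  t = suc t′
  X = sizeClass n k m ℓ 4096 t
  W = (n ^ k) ^ m
  4096t≤n : 4096 * t ≤ n
  4096t≤n = ≤-trans (≤-reflexive (*-comm 4096 t)) (<⇒≤ (<ᵇ⇒< _ _ (subst T (sym small) _)))
  t≤n : t ≤ n
  t≤n = ≤-trans (m≤n*m t 4096) 4096t≤n
  q = n / t
  instance
    q≢0 : NonZero q
    q≢0 = >-nonZero (m≥n⇒m/n>0 t≤n)
  n≤2qt : n ≤ q * (2 * t)
  n≤2qt = n≤n/t*[2*t] n t t≤n
  m+n≤4qt : m + n ≤ q * (4 * t)
  m+n≤4qt = begin
    m + n                        ≤⟨ +-mono-≤ (≤-trans m≤n n≤2qt) n≤2qt ⟩
    q * (2 * t) + q * (2 * t)    ≡⟨ double q t ⟩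
    q * (4 * t)                  ∎
    where
    open ≤-Reasoning
    double : ∀ q t → q * (2 * t) + q * (2 * t) ≡ q * (4 * t)
    double = solve-∀

∑*2^T+c≤c*2^T : ∀ T (f : ℕ → ℕ) c → (∀ t′ → f t′ * 2 ^ suc t′ ≤ c) → ∑ (downFrom T) f * 2 ^ T + c ≤ c * 2 ^ T
∑*2^T+c≤c*2^T zero    f c f≤ = ≤-reflexive (sym (*-identityʳ c))
∑*2^T+c≤c*2^T (suc T) f c f≤ = begin
  (f T + A) * (2 * x) + c             ≡⟨ expand (f T) A x c ⟩
  f T * (2 * x) + (A * x + (A * x + c)) ≤⟨ +-monoˡ-≤ _ (f≤ T) ⟩
  c + (A * x + (A * x + c))           ≡⟨ collect A x c ⟩
  2 * (A * x + c)                     ≤⟨ *-monoʳ-≤ 2 (∑*2^T+c≤c*2^T T f c f≤) ⟩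
  2 * (c * x)                         ≡⟨ swap c x ⟩
  c * (2 * x)                         ∎
  where
  open ≤-Reasoning
  A = ∑ (downFrom T) f
  x = 2 ^ T
  expand : ∀ a A x c → (a + A) * (2 * x) + c ≡ a * (2 * x) + (A * x + (A * x + c))
  expand = solve-∀
  collect : ∀ A x c → c + (A * x + (A * x + c)) ≡ 2 * (A * x + c)
  collect = solve-∀
  swap : ∀ c x → 2 * (c * x) ≡ c * (2 * x)
  swap = solve-∀

∑-halving : ∀ T (f : ℕ → ℕ) c → (∀ t′ → f t′ * 2 ^ suc t′ ≤ c) → ∑ (downFrom T) f ≤ c
∑-halving T f c f≤ = *-cancelʳ-≤ _ _ (2 ^ T) {{m^n≢0 2 T}} (≤-trans (m≤m+n _ c) (∑*2^T+c≤c*2^T T f c f≤))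

badCount*n≤8192*W : ∀ n k m ℓ → 2 ≤ k → 2 ≤ ℓ → m ≤ n → badCount n k m ℓ 4096 * n ≤ 8192 * (n ^ k) ^ m
badCount*n≤8192*W n k m ℓ 2≤k 2≤ℓ m≤n = begin
  badCount n k m ℓ 4096 * n                                      ≤⟨ *-monoˡ-≤ n (badCount≤∑sizeClass n k m ℓ 4096) ⟩
  ∑ (downFrom n) (λ t′ → sizeClass n k m ℓ 4096 (suc t′)) * n    ≡⟨ sym (∑-*ʳ n (downFrom n) _) ⟩
  ∑ (downFrom n) (λ t′ → sizeClass n k m ℓ 4096 (suc t′) * n)    ≤⟨ ∑-halving n _ _ (λ t′ → sizeClass-bound n k m ℓ t′ 2≤k 2≤ℓ m≤n) ⟩
  8192 * (n ^ k) ^ m                                             ∎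
  where open ≤-Reasoning

B*M<W : ∀ c B M n W .{{_ : NonZero c}} → 0 < W → c * M < n → B * n ≤ c * W → B * M < W
B*M<W c zero    M n W 0<W cM<n Bn≤cW = 0<W
B*M<W c (suc b) M n W 0<W cM<n Bn≤cW = *-cancelˡ-< c _ _ (begin-strict
  c * (suc b * M)     ≡⟨ swap c (suc b) M ⟩
  suc b * (c * M)     <⟨ *-monoʳ-< (suc b) cM<n ⟩
  suc b * n           ≤⟨ Bn≤cW ⟩
  c * W               ∎)
  where
  open ≤-Reasoning
  swap : ∀ c b M → c * (b * M) ≡ b * (c * M)
  swap = solve-∀

lemma5 : (k ℓ : ℕ) → 2 ≤ k → 2 ≤ ℓ →
         (m : ℕ → ℕ) → (∀ n → m n ≤ n) →
         ∃[ D ] (1 ≤ D × (∀ M → 1 ≤ M → ∃[ N ] (∀ n → N ≤ n →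
           badCount n k (m n) ℓ D * M < n ^ (k * m n))))
lemma5 k ℓ 2≤k 2≤ℓ m m≤n = 4096 , s≤s z≤n , λ M _ → suc (8192 * M) , λ n 8192M<n →
  subst (badCount n k (m n) ℓ 4096 * M <_) (^-*-assoc n k (m n))
    (B*M<W 8192 (badCount n k (m n) ℓ 4096) M n ((n ^ k) ^ m n) (m^n>0 (n ^ k) {{m^n≢0 n k {{>-nonZero (≤-trans (s≤s z≤n) 8192M<n)}}}} (m n))
      8192M<n (badCount*n≤8192*W n k (m n) ℓ 2≤k 2≤ℓ (m≤n n)))
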